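{- Let $n$ be even and let $(C_0,C_1)$ be a partition of the vertex set of the halved $n$-cube $\frac12 H(n)$. For $i=0,1$ let $C'_i=\{(x_1,\ldots,x_{n-1}) : (x_1,\ldots,x_n)\in C_i\}$ be obtained by deleting the last coordinate, so that $(C'_0,C'_1)$ is a partition of the vertex set of the $(n-1)$-cube $H(n-1)$. Then $(C_0,C_1)$ is an equitable partition of $\frac12 H(n)$ with quotient matrix $S$ having eigenvalue $\theta_{n/2}(n)=-n/2$ if and only if $(C'_0,C'_1)$ is an equitable partition of $H(n-1)$ with quotient matrix $S'=\begin{pmatrix} c-1 & n-c\\ c & n-c-1\end{pmatrix}$ for some $c$, and $S=\frac{S'^2-(n-1)\mathrm{Id}}{2}+S'$.
   Context: The $m$-cube $H(m)$ is the graph on all binary words of length $m$, two words adjacent iff they differ in exactly one position. The halved $n$-cube $\frac12 H(n)$ is the graph on the binary words of length $n$ with an even number of ones, two words adjacent iff they differ in exactly two positions. The eigenvalues of $\frac12 H(n)$ are $\theta_i(n)=((n-2i)^2-n)/2$, $i=0,\ldots,\lfloor n/2\rfloor$; for even $n$ the minimum one is $\theta_{n/2}(n)=-n/2$. An equitable $2$-partition of a graph is an ordered partition $(C_0,C_1)$ of the vertex set such that the number of neighbors in $C_j$ of a vertex of $C_i$ is a constant $S_{ij}$; $S=(S_{ij})$ is the quotient matrix, and "eigenvalue of the partition" means the eigenvalue of $S$ other than the graph degree. -}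

module Defs where

open import Data.Bool using (Bool; true; false; not; _∧_; _xor_; if_then_else_)
open import Data.Nat using (ℕ; zero; suc; _≡ᵇ_)
open import Data.Integer as ℤ using (ℤ; +_; _-_; _*_; _+_)
open import Data.Fin using (Fin; zero; suc; _≟_)
open import Data.Vec using (Vec; []; _∷_; _∷ʳ_; foldr; zipWith)
open import Data.List using (List; []; _∷_; concatMap)
open import Data.List.Membership.Propositional using (_∈_)
open import Data.Product using (Σ; _×_)
open import Relation.Nullary using (¬_)
open import Relation.Nullary.Decidable using (⌊_⌋)
open import Relation.Binary.PropositionalEquality using (_≡_)

countB : {A : Set} → (A → Bool) → List A → ℕ
countB p [] = zero
countB p (x ∷ xs) = if p x then suc (countB p xs) else countB p xs

filterB : {A : Set} → (A → Bool) → List A → List A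
filterB p [] = []
filterB p (x ∷ xs) = if p x then x ∷ filterB p xs else filterB p xs

-- a finite graph: a list of its vertices (each listed once) and a
-- (symmetric, irreflexive) boolean adjacency relation
record FinGraph : Set₁ where
  field
    V        : Set
    vertices : List V
    adj      : V → V → Bool
open FinGraph public

-- An ordered 2-partition (C₀ , C₁) of the vertex set of G is given by
-- P : V → Fin 2 (v ∈ C_i iff P v ≡ i), restricted to the vertices of G.
IsEquitable : (G : FinGraph) → (V G → Fin 2) → (Fin 2 → Fin 2 → ℕ) → Set
IsEquitable G P S =
  ((i : Fin 2) → Σ (V G) λ v → (v ∈ vertices G) × (P v ≡ i))
  × ((v : V G) → v ∈ vertices G → (j : Fin 2) →
       countB (λ w → adj G v w ∧ ⌊ P w ≟ j ⌋) (vertices G) ≡ S (P v) j)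

words : (m : ℕ) → List (Vec Bool m)
words zero = [] ∷ []
words (suc m) = concatMap (λ w → (false ∷ w) ∷ (true ∷ w) ∷ []) (words m)

dist : {m : ℕ} → Vec Bool m → Vec Bool m → ℕ
dist x y = foldr _ (λ b k → if b then suc k else k) zero (zipWith _xor_ x y)

parity : {m : ℕ} → Vec Bool m → Bool
parity x = foldr _ _xor_ false x

H : ℕ → FinGraph
H m = record { V = Vec Bool m ; vertices = words m ; adj = λ x y → dist x y ≡ᵇ 1 }

halfH : ℕ → FinGraph
halfH n = record
  { V = Vec Bool n
  ; vertices = filterB (λ x → not (parity x)) (words n)
  ; adj = λ x y → dist x y ≡ᵇ 2 }

-- deleting the last coordinate is a bijection from the even words of
-- length m+1 onto all words of length m; its inverse appends the parity bit.
deleteLast : {m : ℕ} → Vec Bool (suc m) → Vec Bool m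
deleteLast (b ∷ []) = []
deleteLast (b ∷ c ∷ x) = b ∷ deleteLast (c ∷ x)

extendEven : {m : ℕ} → Vec Bool m → Vec Bool (suc m)
extendEven y = y ∷ʳ parity y

Mat : Set
Mat = Fin 2 → Fin 2 → ℤ

toℤM : (Fin 2 → Fin 2 → ℕ) → Mat
toℤM S i j = + S i j

HasEigenvalue : Mat → ℤ → Set
HasEigenvalue M λ′ = Σ (Fin 2 → ℤ) λ v →
  (¬ ((i : Fin 2) → v i ≡ + 0))
  × ((i : Fin 2) → M i zero * v zero + M i (suc zero) * v (suc zero) ≡ λ′ * v i)

_·_ : Mat → Mat → Mat
(A · B) i j = A i zero * B zero j + A i (suc zero) * B (suc zero) j

δ : Fin 2 → Fin 2 → ℤ
δ i j = if ⌊ i ≟ j ⌋ then + 1 else + 0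

S′ : ℕ → ℤ → Mat
S′ n c zero zero = c - + 1
S′ n c zero (suc zero) = + n - c
S′ n c (suc zero) zero = c
S′ n c (suc zero) (suc zero) = + n - c - + 1

-- Deleting the last coordinate identifies ½H(m+1) with the graph on the words of length m whose
-- adjacency operator is A + A₂ = A + (A² − m·I)/2, A being that of H(m). Hence a partition equitable
-- for H(m) with quotient S′ is equitable for ½H(m+1) with quotient (S′² − m·I)/2 + S′, and the
-- eigenvalue −1 of S′ becomes −(m+1)/2. Conversely, an eigenvector of the quotient for −(m+1)/2
-- lifts to a function F with AF = −F taking distinct values on the two cells, and counting
-- neighbours through AF = −F shows that the partition is equitable for H(m), with quotient of the
-- shape S′.
module Submission where

module HalvedCube where

  open import Defs
  open import Data.Bool using (Bool; true; false; not; _∧_; _∨_; _xor_; if_then_else_)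
  open import Data.Bool.Properties
    using (not-involutive; xor-comm; xor-assoc; xor-same; xor-identityʳ; not-distribˡ-xor; not-distribʳ-xor)
  open import Data.Nat as ℕ using (ℕ; zero; suc; _≡ᵇ_)
  import Data.Nat.Properties as ℕ
  open import Data.Integer
    using (ℤ; +_; -_; _-_; _+_; _*_; ∣_∣; 0ℤ; 1ℤ; -1ℤ; -[1+_]; +0; +[1+_]; ≢-nonZero)
  import Data.Integer.Properties as ℤ
  open import Data.Integer.Tactic.RingSolver using (solve-∀)
  open import Data.Fin using (Fin; zero; suc; _≟_)
  open import Data.Vec using (Vec; []; _∷_; _∷ʳ_; replicate; initLast)
  open import Data.List using (List; []; _∷_; concatMap)
  import Data.List.Relation.Unary.Any as Any
  open import Data.List.Relation.Unary.Any using (here; there)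
  open import Data.List.Membership.Propositional using (_∈_)
  open import Data.List.Membership.Propositional.Properties using (∈-concatMap⁺)
  open import Data.Product using (Σ; ∃-syntax; _×_; _,_; proj₁; proj₂)
  open import Data.Sum using (inj₁; inj₂; reduce)
  open import Relation.Nullary using (¬_)
  open import Relation.Nullary.Decidable using (⌊_⌋)
  open import Relation.Binary.PropositionalEquality

  Word : ℕ → Set
  Word = Vec Bool

  ∑ : ∀ m → (Word m → ℤ) → ℤ
  ∑ zero    f = f []
  ∑ (suc m) f = ∑ m (λ z → f (false ∷ z)) + ∑ m (λ z → f (true ∷ z))

  ∑-cong : ∀ m {f g : Word m → ℤ} → (∀ z → f z ≡ g z) → ∑ m f ≡ ∑ m g
  ∑-cong zero    f≗g = f≗g []
  ∑-cong (suc m) f≗g =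
    cong₂ _+_ (∑-cong m (λ z → f≗g (false ∷ z))) (∑-cong m (λ z → f≗g (true ∷ z)))

  ∑-zero : ∀ m (f : Word m → ℤ) → (∀ z → f z ≡ 0ℤ) → ∑ m f ≡ 0ℤ
  ∑-zero zero    f f≗0 = f≗0 []
  ∑-zero (suc m) f f≗0 =
    cong₂ _+_ (∑-zero m _ (λ z → f≗0 (false ∷ z))) (∑-zero m _ (λ z → f≗0 (true ∷ z)))

  ∑-distrib-+ : ∀ m (f g : Word m → ℤ) → ∑ m (λ z → f z + g z) ≡ ∑ m f + ∑ m g
  ∑-distrib-+ zero    f g = refl
  ∑-distrib-+ (suc m) f g =
    trans (cong₂ _+_ (∑-distrib-+ m (λ z → f (false ∷ z)) (λ z → g (false ∷ z)))
                     (∑-distrib-+ m (λ z → f (true ∷ z)) (λ z → g (true ∷ z))))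
          (interchange (∑ m (λ z → f (false ∷ z))) (∑ m (λ z → g (false ∷ z)))
                       (∑ m (λ z → f (true ∷ z))) (∑ m (λ z → g (true ∷ z))))
    where
    interchange : ∀ a b c d → (a + b) + (c + d) ≡ (a + c) + (b + d)
    interchange = solve-∀

  ∑-*ˡ : ∀ m a (f : Word m → ℤ) → ∑ m (λ z → a * f z) ≡ a * ∑ m f
  ∑-*ˡ zero    a f = refl
  ∑-*ˡ (suc m) a f =
    trans (cong₂ _+_ (∑-*ˡ m a (λ z → f (false ∷ z))) (∑-*ˡ m a (λ z → f (true ∷ z))))
          (sym (ℤ.*-distribˡ-+ a _ _))

  ∑-*ʳ : ∀ m a (f : Word m → ℤ) → ∑ m (λ z → f z * a) ≡ ∑ m f * a
  ∑-*ʳ m a f = trans (∑-cong m (λ z → ℤ.*-comm (f z) a)) (trans (∑-*ˡ m a f) (ℤ.*-comm a (∑ m f)))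

  ∑-comm : ∀ m n (h : Word m → Word n → ℤ) →
           ∑ m (λ y → ∑ n (λ z → h y z)) ≡ ∑ n (λ z → ∑ m (λ y → h y z))
  ∑-comm zero    n h = refl
  ∑-comm (suc m) n h =
    trans (cong₂ _+_ (∑-comm m n (λ y → h (false ∷ y))) (∑-comm m n (λ y → h (true ∷ y))))
          (sym (∑-distrib-+ n _ _))

  ∑-ofℕ : ∀ m (g : Word m → ℕ) → ∃[ k ] ∑ m (λ z → + g z) ≡ + k
  ∑-ofℕ zero    g = g [] , refl
  ∑-ofℕ (suc m) g with ∑-ofℕ m (λ z → g (false ∷ z)) | ∑-ofℕ m (λ z → g (true ∷ z))
  ... | k , p | l , q = k ℕ.+ l , cong₂ _+_ p q

  ∑-ofℕ≡0 : ∀ m (g : Word m → ℕ) → ∑ m (λ z → + g z) ≡ 0ℤ → ∀ z → g z ≡ 0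
  ∑-ofℕ≡0 zero    g ∑≡0 [] = ℤ.+-injective ∑≡0
  ∑-ofℕ≡0 (suc m) g ∑≡0 (b ∷ z)
    with ∑-ofℕ m (λ z → g (false ∷ z)) | ∑-ofℕ m (λ z → g (true ∷ z))
  ... | k , p | l , q with ℤ.+-injective (trans (sym (cong₂ _+_ p q)) ∑≡0)
  ... | k+l≡0 with b
  ...   | false = ∑-ofℕ≡0 m _ (trans p (cong +_ (ℕ.m+n≡0⇒m≡0 k k+l≡0))) z
  ...   | true  = ∑-ofℕ≡0 m _ (trans q (cong +_ (ℕ.m+n≡0⇒n≡0 k k+l≡0))) z

  i*i≡∣i∣*∣i∣ : ∀ i → i * i ≡ + (∣ i ∣ ℕ.* ∣ i ∣)
  i*i≡∣i∣*∣i∣ +0       = refl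
  i*i≡∣i∣*∣i∣ +[1+ n ] = refl
  i*i≡∣i∣*∣i∣ -[1+ n ] = refl

  ∑-squares≡0 : ∀ m (G : Word m → ℤ) → ∑ m (λ z → G z * G z) ≡ 0ℤ → ∀ z → G z ≡ 0ℤ
  ∑-squares≡0 m G ∑≡0 z =
    reduce (ℤ.i*j≡0⇒i≡0∨j≡0 (G z) (trans (i*i≡∣i∣*∣i∣ (G z)) (cong +_ ∣Gz∣²≡0)))
    where
    ∣Gz∣²≡0 : ∣ G z ∣ ℕ.* ∣ G z ∣ ≡ 0
    ∣Gz∣²≡0 = ∑-ofℕ≡0 m (λ z → ∣ G z ∣ ℕ.* ∣ G z ∣)
                (trans (sym (∑-cong m (λ z → i*i≡∣i∣*∣i∣ (G z)))) ∑≡0) z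

  𝟙 : Bool → ℤ
  𝟙 true  = 1ℤ
  𝟙 false = 0ℤ

  𝟙-∧ : ∀ a b → 𝟙 (a ∧ b) ≡ 𝟙 a * 𝟙 b
  𝟙-∧ true  true  = refl
  𝟙-∧ true  false = refl
  𝟙-∧ false b     = refl

  dist-comm : ∀ {m} (y z : Word m) → dist y z ≡ dist z y
  dist-comm []      []      = refl
  dist-comm (a ∷ y) (b ∷ z) = cong₂ (λ c k → if c then suc k else k) (xor-comm a b) (dist-comm y z)

  A : ∀ m → ℕ → (Word m → ℤ) → Word m → ℤ
  A m d f y = ∑ m (λ z → 𝟙 (dist y z ≡ᵇ d) * f z)

  A-cong : ∀ m d {f g : Word m → ℤ} → (∀ z → f z ≡ g z) → ∀ y → A m d f y ≡ A m d g y
  A-cong m d f≗g y = ∑-cong m (λ z → cong (𝟙 (dist y z ≡ᵇ d) *_) (f≗g z))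

  A-+ : ∀ m d (f g : Word m → ℤ) y → A m d (λ z → f z + g z) y ≡ A m d f y + A m d g y
  A-+ m d f g y =
    trans (∑-cong m (λ z → ℤ.*-distribˡ-+ (𝟙 (dist y z ≡ᵇ d)) (f z) (g z))) (∑-distrib-+ m _ _)

  A-*ˡ : ∀ m d a (f : Word m → ℤ) y → A m d (λ z → a * f z) y ≡ a * A m d f y
  A-*ˡ m d a f y = trans (∑-cong m (λ z → swap (𝟙 (dist y z ≡ᵇ d)) a (f z))) (∑-*ˡ m a _)
    where
    swap : ∀ e a f → e * (a * f) ≡ a * (e * f)
    swap = solve-∀

  A-symmetric : ∀ m d (f g : Word m → ℤ) →
                ∑ m (λ y → f y * A m d g y) ≡ ∑ m (λ y → A m d f y * g y)
  A-symmetric m d f g = begin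
      ∑ m (λ y → f y * A m d g y)
    ≡⟨ ∑-cong m (λ y → sym (∑-*ˡ m (f y) _)) ⟩
      ∑ m (λ y → ∑ m (λ z → f y * (𝟙 (dist y z ≡ᵇ d) * g z)))
    ≡⟨ ∑-comm m m _ ⟩
      ∑ m (λ z → ∑ m (λ y → f y * (𝟙 (dist y z ≡ᵇ d) * g z)))
    ≡⟨ ∑-cong m (λ z → ∑-cong m (λ y → regroup y z)) ⟩
      ∑ m (λ z → ∑ m (λ y → (𝟙 (dist z y ≡ᵇ d) * f y) * g z))
    ≡⟨ ∑-cong m (λ z → ∑-*ʳ m (g z) _) ⟩
      ∑ m (λ z → A m d f z * g z) ∎
    where
    open ≡-Reasoning
    reassoc : ∀ a e b → a * (e * b) ≡ (e * a) * b
    reassoc = solve-∀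
    regroup : ∀ y z → f y * (𝟙 (dist y z ≡ᵇ d) * g z) ≡ (𝟙 (dist z y ≡ᵇ d) * f y) * g z
    regroup y z = trans (reassoc (f y) (𝟙 (dist y z ≡ᵇ d)) (g z))
                        (cong (λ k → (𝟙 (k ≡ᵇ d) * f y) * g z) (dist-comm y z))

  A↓ : ∀ m → ℕ → (Word m → ℤ) → Word m → ℤ
  A↓ m zero    f y = 0ℤ
  A↓ m (suc d) f y = A m d f y

  -- The distance-d neighbours of b ∷ y are b ∷ z with z at distance d from y and
  -- not b ∷ z with z at distance d - 1 from y.
  A-∷ : ∀ m d (f : Word (suc m) → ℤ) b y →
        A (suc m) d f (b ∷ y) ≡ A m d (λ z → f (b ∷ z)) y + A↓ m d (λ z → f (not b ∷ z)) y
  A-∷ m zero    f false y =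
    cong (_+_ (A m 0 (λ z → f (false ∷ z)) y)) (∑-zero m (λ z → 0ℤ * f (true ∷ z)) (λ z → refl))
  A-∷ m (suc d) f false y = refl
  A-∷ m zero    f true  y =
    trans (cong (_+ A m 0 (λ z → f (true ∷ z)) y) (∑-zero m (λ z → 0ℤ * f (false ∷ z)) (λ z → refl)))
          (ℤ.+-comm 0ℤ (A m 0 (λ z → f (true ∷ z)) y))
  A-∷ m (suc d) f true  y = ℤ.+-comm (A m d (λ z → f (false ∷ z)) y) _

  A-zero : ∀ m (f : Word m → ℤ) y → A m 0 f y ≡ f y
  A-zero zero    f []      = ℤ.*-identityˡ (f [])
  A-zero (suc m) f (b ∷ y) = trans (A-∷ m 0 f b y) (trans (ℤ.+-identityʳ _) (A-zero m _ y))

  A-∷₁ : ∀ m (f : Word (suc m) → ℤ) b y →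
         A (suc m) 1 f (b ∷ y) ≡ A m 1 (λ z → f (b ∷ z)) y + f (not b ∷ y)
  A-∷₁ m f b y = trans (A-∷ m 1 f b y) (cong (_+_ (A m 1 (λ z → f (b ∷ z)) y)) (A-zero m _ y))

  A-const : ∀ m y → A m 1 (λ _ → 1ℤ) y ≡ + m
  A-const zero    []      = refl
  A-const (suc m) (b ∷ y) =
    trans (A-∷₁ m (λ _ → 1ℤ) b y) (trans (cong (_+ 1ℤ) (A-const m y)) (cong +_ (ℕ.+-comm m 1)))

  -- A₁² = m·I + 2A₂: a word at distance 2 is reached along two paths of length 2, and y itself along m.
  A-square : ∀ m (f : Word m → ℤ) y → A m 1 (A m 1 f) y ≡ + m * f y + + 2 * A m 2 f y
  A-square zero    f []      = sym (ℤ.*-zeroʳ (+ 2))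
  A-square (suc m) f (b ∷ y) = begin
      A (suc m) 1 (A (suc m) 1 f) (b ∷ y)
    ≡⟨ A-∷₁ m (A (suc m) 1 f) b y ⟩
      A m 1 (λ z → A (suc m) 1 f (b ∷ z)) y + A (suc m) 1 f (not b ∷ y)
    ≡⟨ cong₂ _+_ (trans (A-cong m 1 (λ z → A-∷₁ m f b z) y) (A-+ m 1 (A m 1 f₀) f₁ y))
                 (A-∷₁ m f (not b) y) ⟩
      (A m 1 (A m 1 f₀) y + A m 1 f₁ y) + (A m 1 f₁ y + f (not (not b) ∷ y))
    ≡⟨ cong₂ _+_ (cong (_+ A m 1 f₁ y) (A-square m f₀ y))
                 (cong (λ c → A m 1 f₁ y + f (c ∷ y)) (not-involutive b)) ⟩
      ((+ m * f (b ∷ y) + + 2 * A m 2 f₀ y) + A m 1 f₁ y) + (A m 1 f₁ y + f (b ∷ y))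
    ≡⟨ regroup (+ m) (f (b ∷ y)) (A m 2 f₀ y) (A m 1 f₁ y) ⟩
      + suc m * f (b ∷ y) + + 2 * (A m 2 f₀ y + A m 1 f₁ y)
    ≡⟨ cong (λ t → + suc m * f (b ∷ y) + + 2 * t) (sym (A-∷ m 2 f b y)) ⟩
      + suc m * f (b ∷ y) + + 2 * A (suc m) 2 f (b ∷ y) ∎
    where
    open ≡-Reasoning
    f₀ f₁ : Word m → ℤ
    f₀ z = f (b ∷ z)
    f₁ z = f (not b ∷ z)
    regroup : ∀ k x p q → ((k * x + + 2 * p) + q) + (q + x) ≡ (+ 1 + k) * x + + 2 * (p + q)
    regroup = solve-∀

  -- Transported along extendEven, this is the adjacency operator of ½H(m+1).
  A½ : ∀ m → (Word m → ℤ) → Word m → ℤ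
  A½ m f y = A m 1 f y + A m 2 f y

  -- G = (A + I)F satisfies (A + I)G = A²F + 2AF + F = 2A½F + (m+1)F = 0, hence ⟨G,G⟩ = ⟨(A+I)G,F⟩ = 0.
  A½-eigen⇒A-eigen : ∀ m θ → + 2 * θ ≡ - + suc m → (F : Word m → ℤ) →
                     (∀ y → A½ m F y ≡ θ * F y) → ∀ y → A m 1 F y ≡ - F y
  A½-eigen⇒A-eigen m θ 2θ≡-n F A½F≡θF y =
    trans (isolate (A m 1 F y) (F y))
          (trans (cong (_- F y) (∑-squares≡0 m G ∑G²≡0 y)) (ℤ.+-identityˡ (- F y)))
    where
    open ≡-Reasoning
    G : Word m → ℤ
    G y = A m 1 F y + F y
    [A+I]G≡0 : ∀ y → A m 1 G y + G y ≡ 0ℤ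
    [A+I]G≡0 y = begin
        A m 1 G y + G y
      ≡⟨ cong (_+ G y) (A-+ m 1 (A m 1 F) F y) ⟩
        (A m 1 (A m 1 F) y + A m 1 F y) + (A m 1 F y + F y)
      ≡⟨ cong (λ t → (t + A m 1 F y) + (A m 1 F y + F y)) (A-square m F y) ⟩
        ((+ m * F y + + 2 * A m 2 F y) + A m 1 F y) + (A m 1 F y + F y)
      ≡⟨ regroup (+ m) (F y) (A m 1 F y) (A m 2 F y) ⟩
        + 2 * A½ m F y + (1ℤ + + m) * F y
      ≡⟨ cong (λ t → + 2 * t + (1ℤ + + m) * F y) (A½F≡θF y) ⟩
        + 2 * (θ * F y) + (1ℤ + + m) * F y
      ≡⟨ collect θ (F y) (+ m) ⟩
        (+ 2 * θ + (1ℤ + + m)) * F y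
      ≡⟨ cong (λ t → (t + (1ℤ + + m)) * F y) 2θ≡-n ⟩
        (- (1ℤ + + m) + (1ℤ + + m)) * F y
      ≡⟨ cancel (1ℤ + + m) (F y) ⟩
        0ℤ ∎
      where
      regroup : ∀ k f a a₂ → ((k * f + + 2 * a₂) + a) + (a + f) ≡ + 2 * (a + a₂) + (1ℤ + k) * f
      regroup = solve-∀
      collect : ∀ θ f k → + 2 * (θ * f) + (1ℤ + k) * f ≡ (+ 2 * θ + (1ℤ + k)) * f
      collect = solve-∀
      cancel : ∀ k f → (- k + k) * f ≡ 0ℤ
      cancel = solve-∀
    ∑G²≡0 : ∑ m (λ y → G y * G y) ≡ 0ℤ
    ∑G²≡0 = begin
        ∑ m (λ y → G y * G y)
      ≡⟨ ∑-cong m (λ y → ℤ.*-distribˡ-+ (G y) (A m 1 F y) (F y)) ⟩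
        ∑ m (λ y → G y * A m 1 F y + G y * F y)
      ≡⟨ ∑-distrib-+ m _ _ ⟩
        ∑ m (λ y → G y * A m 1 F y) + ∑ m (λ y → G y * F y)
      ≡⟨ cong (_+ ∑ m (λ y → G y * F y)) (A-symmetric m 1 G F) ⟩
        ∑ m (λ y → A m 1 G y * F y) + ∑ m (λ y → G y * F y)
      ≡⟨ sym (∑-distrib-+ m _ _) ⟩
        ∑ m (λ y → A m 1 G y * F y + G y * F y)
      ≡⟨ ∑-zero m _ (λ y → trans (sym (ℤ.*-distribʳ-+ (F y) (A m 1 G y) (G y)))
                                (trans (cong (_* F y) ([A+I]G≡0 y)) (ℤ.*-zeroˡ (F y)))) ⟩
        0ℤ ∎
    isolate : ∀ a f → a ≡ (a + f) - f
    isolate = solve-∀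

  odd : ℕ → Bool
  odd zero    = false
  odd (suc n) = not (odd n)

  parity-∷ʳ : ∀ {m} (y : Word m) a → parity (y ∷ʳ a) ≡ parity y xor a
  parity-∷ʳ []      a = xor-identityʳ a
  parity-∷ʳ (b ∷ y) a = trans (cong (b xor_) (parity-∷ʳ y a)) (sym (xor-assoc b (parity y) a))

  parity-extendEven : ∀ {m} (y : Word m) → parity (extendEven y) ≡ false
  parity-extendEven y = trans (parity-∷ʳ y (parity y)) (xor-same (parity y))

  deleteLast-∷ʳ : ∀ {m} (y : Word m) a → deleteLast (y ∷ʳ a) ≡ y
  deleteLast-∷ʳ []          a = refl
  deleteLast-∷ʳ (b ∷ [])    a = refl
  deleteLast-∷ʳ (b ∷ c ∷ y) a = cong (b ∷_) (deleteLast-∷ʳ (c ∷ y) a)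

  xor≡false⇒≡ : ∀ a b → a xor b ≡ false → a ≡ b
  xor≡false⇒≡ false false _ = refl
  xor≡false⇒≡ true  true  _ = refl

  extendEven-deleteLast : ∀ {m} (x : Word (suc m)) → parity x ≡ false → extendEven (deleteLast x) ≡ x
  extendEven-deleteLast x even with initLast x
  ... | y , a , refl rewrite deleteLast-∷ʳ y a =
    cong (y ∷ʳ_) (xor≡false⇒≡ (parity y) a (trans (sym (parity-∷ʳ y a)) even))

  dist-∷ʳ : ∀ {m} (y z : Word m) a b → dist (y ∷ʳ a) (z ∷ʳ b) ≡ dist (a ∷ y) (b ∷ z)
  dist-∷ʳ []      []      a b = refl
  dist-∷ʳ (c ∷ y) (d ∷ z) a b rewrite dist-∷ʳ y z a b with c xor d | a xor b
  ... | true  | true  = refl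
  ... | true  | false = refl
  ... | false | true  = refl
  ... | false | false = refl

  parity-dist : ∀ {m} (y z : Word m) → parity y xor parity z ≡ odd (dist y z)
  parity-dist []          []          = refl
  parity-dist (false ∷ y) (false ∷ z) = parity-dist y z
  parity-dist (false ∷ y) (true ∷ z)  =
    trans (sym (not-distribʳ-xor (parity y) (parity z))) (cong not (parity-dist y z))
  parity-dist (true ∷ y)  (false ∷ z) =
    trans (sym (not-distribˡ-xor (parity y) (parity z))) (cong not (parity-dist y z))
  parity-dist (true ∷ y)  (true ∷ z)  = begin
      not (parity y) xor not (parity z)
    ≡⟨ sym (not-distribˡ-xor (parity y) (not (parity z))) ⟩
      not (parity y xor not (parity z))
    ≡⟨ cong not (sym (not-distribʳ-xor (parity y) (parity z))) ⟩
      not (not (parity y xor parity z))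
    ≡⟨ not-involutive _ ⟩
      parity y xor parity z
    ≡⟨ parity-dist y z ⟩
      odd (dist y z) ∎
    where open ≡-Reasoning

  -- Appending parity bits adds one to every odd distance, so distance 2 in ½H(m+1) is
  -- distance 1 or 2 in H(m).
  dist-extendEven : ∀ {m} (y z : Word m) →
    (dist (extendEven y) (extendEven z) ≡ᵇ 2) ≡ ((dist y z ≡ᵇ 1) ∨ (dist y z ≡ᵇ 2))
  dist-extendEven y z =
    trans (cong (λ k → k ≡ᵇ 2) (trans (dist-∷ʳ y z (parity y) (parity z))
                                     (cong (λ c → if c then suc (dist y z) else dist y z) (parity-dist y z))))
          (evenize (dist y z))
    where
    evenize : ∀ d → ((if odd d then suc d else d) ≡ᵇ 2) ≡ ((d ≡ᵇ 1) ∨ (d ≡ᵇ 2))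
    evenize 0 = refl
    evenize 1 = refl
    evenize 2 = refl
    evenize (suc (suc (suc d))) with odd d
    ... | true  = refl
    ... | false = refl

  countB-concatMap : ∀ {m} (p : Word (suc m) → Bool) (xs : List (Word m)) →
    countB p (concatMap (λ w → (false ∷ w) ∷ (true ∷ w) ∷ []) xs)
      ≡ countB (λ w → p (false ∷ w)) xs ℕ.+ countB (λ w → p (true ∷ w)) xs
  countB-concatMap p []       = refl
  countB-concatMap p (w ∷ ws) with p (false ∷ w) | p (true ∷ w) | countB-concatMap p ws
  ... | true  | true  | ih = cong suc (trans (cong suc ih) (sym (ℕ.+-suc _ _)))
  ... | true  | false | ih = cong suc ih
  ... | false | true  | ih = trans (cong suc ih) (sym (ℕ.+-suc _ _))
  ... | false | false | ih = ih

  countB-words : ∀ m (p : Word m → Bool) → + countB p (words m) ≡ ∑ m (λ z → 𝟙 (p z))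
  countB-words zero    p with p []
  ... | true  = refl
  ... | false = refl
  countB-words (suc m) p =
    trans (cong +_ (countB-concatMap p (words m)))
          (cong₂ _+_ (countB-words m (λ w → p (false ∷ w))) (countB-words m (λ w → p (true ∷ w))))

  countB-filterB : ∀ {X : Set} (q r : X → Bool) xs → countB q (filterB r xs) ≡ countB (λ x → r x ∧ q x) xs
  countB-filterB q r []       = refl
  countB-filterB q r (x ∷ xs) with r x
  ... | true  = cong (λ k → if q x then suc k else k) (countB-filterB q r xs)
  ... | false = countB-filterB q r xs

  -- Stated for either parity b, since dropping a leading 1 flips the parity.
  ∑-parity : ∀ m b (q : Word (suc m) → Bool) →
    ∑ (suc m) (λ x → 𝟙 (not (parity x xor b) ∧ q x)) ≡ ∑ m (λ y → 𝟙 (q (y ∷ʳ (parity y xor b))))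
  ∑-parity zero    true  q = ℤ.+-identityˡ _
  ∑-parity zero    false q = ℤ.+-identityʳ _
  ∑-parity (suc m) b     q = cong₂ _+_
    (∑-parity m b (λ x → q (false ∷ x)))
    (trans (∑-cong (suc m) (λ x → cong (λ c → 𝟙 (not c ∧ q (true ∷ x))) (flip (parity x))))
           (trans (∑-parity m (not b) (λ x → q (true ∷ x)))
                  (∑-cong m (λ y → cong (λ c → 𝟙 (q (true ∷ (y ∷ʳ c)))) (sym (flip (parity y)))))))
    where
    flip : ∀ a → not a xor b ≡ a xor not b
    flip a = trans (sym (not-distribˡ-xor a b)) (not-distribʳ-xor a b)

  ∑-even : ∀ m (q : Word (suc m) → Bool) →
    ∑ (suc m) (λ x → 𝟙 (not (parity x) ∧ q x)) ≡ ∑ m (λ y → 𝟙 (q (extendEven y)))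
  ∑-even m q =
    trans (∑-cong (suc m) (λ x → cong (λ c → 𝟙 (not c ∧ q x)) (sym (xor-identityʳ (parity x)))))
          (trans (∑-parity m false q)
                 (∑-cong m (λ y → cong (λ c → 𝟙 (q (y ∷ʳ c))) (xor-identityʳ (parity y)))))

  cube-neighbours : ∀ m (p : Word m → Bool) y →
    + countB (λ w → adj (H m) y w ∧ p w) (vertices (H m)) ≡ A m 1 (λ z → 𝟙 (p z)) y
  cube-neighbours m p y = trans (countB-words m _) (∑-cong m (λ z → 𝟙-∧ (dist y z ≡ᵇ 1) (p z)))

  halvedCube-neighbours : ∀ m (p : Word (suc m) → Bool) y →
    + countB (λ w → adj (halfH (suc m)) (extendEven y) w ∧ p w) (vertices (halfH (suc m)))
      ≡ A½ m (λ z → 𝟙 (p (extendEven z))) y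
  halvedCube-neighbours m p y = begin
      + countB q (filterB (λ x → not (parity x)) (words (suc m)))
    ≡⟨ cong +_ (countB-filterB q (λ x → not (parity x)) (words (suc m))) ⟩
      + countB (λ x → not (parity x) ∧ q x) (words (suc m))
    ≡⟨ countB-words (suc m) _ ⟩
      ∑ (suc m) (λ x → 𝟙 (not (parity x) ∧ q x))
    ≡⟨ ∑-even m q ⟩
      ∑ m (λ z → 𝟙 (q (extendEven z)))
    ≡⟨ ∑-cong m (λ z → trans (cong (λ c → 𝟙 (c ∧ p (extendEven z))) (dist-extendEven y z))
                             (𝟙-∨-∧ (dist y z) (p (extendEven z)))) ⟩
      ∑ m (λ z → 𝟙 (dist y z ≡ᵇ 1) * 𝟙 (p (extendEven z))
                 + 𝟙 (dist y z ≡ᵇ 2) * 𝟙 (p (extendEven z)))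
    ≡⟨ ∑-distrib-+ m _ _ ⟩
      A m 1 (λ z → 𝟙 (p (extendEven z))) y + A m 2 (λ z → 𝟙 (p (extendEven z))) y ∎
    where
    open ≡-Reasoning
    q : Word (suc m) → Bool
    q w = (dist (extendEven y) w ≡ᵇ 2) ∧ p w
    𝟙-∨-∧ : ∀ d c → 𝟙 (((d ≡ᵇ 1) ∨ (d ≡ᵇ 2)) ∧ c) ≡ 𝟙 (d ≡ᵇ 1) * 𝟙 c + 𝟙 (d ≡ᵇ 2) * 𝟙 c
    𝟙-∨-∧ 0                   c     = refl
    𝟙-∨-∧ 1                   true  = refl
    𝟙-∨-∧ 1                   false = refl
    𝟙-∨-∧ 2                   true  = refl
    𝟙-∨-∧ 2                   false = refl
    𝟙-∨-∧ (suc (suc (suc d))) c     = refl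

  ∈-words : ∀ {m} (y : Word m) → y ∈ words m
  ∈-words []      = here refl
  ∈-words (b ∷ y) =
    ∈-concatMap⁺ (λ w → (false ∷ w) ∷ (true ∷ w) ∷ []) (Any.map (∈-pair b) (∈-words y))
    where
    ∈-pair : ∀ b {w} → y ≡ w → (b ∷ y) ∈ (false ∷ w) ∷ (true ∷ w) ∷ []
    ∈-pair false refl = here refl
    ∈-pair true  refl = there (here refl)

  ∈-filterB⁺ : ∀ {X : Set} (r : X → Bool) {x} xs → r x ≡ true → x ∈ xs → x ∈ filterB r xs
  ∈-filterB⁺ r (x ∷ xs) rx (here refl) rewrite rx = here refl
  ∈-filterB⁺ r (w ∷ xs) rx (there x∈) with r w
  ... | true  = there (∈-filterB⁺ r xs rx x∈)
  ... | false = ∈-filterB⁺ r xs rx x∈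

  ∈-filterB⁻ : ∀ {X : Set} (r : X → Bool) {x} xs → x ∈ filterB r xs → r x ≡ true
  ∈-filterB⁻ r (w ∷ xs) x∈ with r w in rw
  ∈-filterB⁻ r (w ∷ xs) (here refl) | true  = rw
  ∈-filterB⁻ r (w ∷ xs) (there x∈)  | true  = ∈-filterB⁻ r xs x∈
  ∈-filterB⁻ r (w ∷ xs) x∈          | false = ∈-filterB⁻ r xs x∈

  extendEven-∈ : ∀ m (y : Word m) → extendEven y ∈ vertices (halfH (suc m))
  extendEven-∈ m y =
    ∈-filterB⁺ (λ x → not (parity x)) (words (suc m))
               (cong not (parity-extendEven y)) (∈-words (extendEven y))

  ∈⇒extendEven-deleteLast : ∀ m {x} → x ∈ vertices (halfH (suc m)) → extendEven (deleteLast x) ≡ x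
  ∈⇒extendEven-deleteLast m {x} x∈ =
    extendEven-deleteLast x
      (trans (sym (not-involutive _)) (cong not (∈-filterB⁻ (λ x → not (parity x)) (words (suc m)) x∈)))

  _*ᵥ_ : Mat → (Fin 2 → ℤ) → Fin 2 → ℤ
  (M *ᵥ v) i = M i zero * v zero + M i (suc zero) * v (suc zero)

  *ᵥ-cong : ∀ {M N : Mat} → (∀ i j → M i j ≡ N i j) → ∀ v i → (M *ᵥ v) i ≡ (N *ᵥ v) i
  *ᵥ-cong M≗N v i = cong₂ (λ a b → a * v zero + b * v (suc zero)) (M≗N i zero) (M≗N i (suc zero))

  δ-*ᵥ : ∀ v i → (δ *ᵥ v) i ≡ v i
  δ-*ᵥ v zero       = first (v zero) (v (suc zero))
    where
    first : ∀ a b → 1ℤ * a + 0ℤ * b ≡ a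
    first = solve-∀
  δ-*ᵥ v (suc zero) = second (v zero) (v (suc zero))
    where
    second : ∀ a b → 0ℤ * a + 1ℤ * b ≡ b
    second = solve-∀

  ·-*ᵥ : ∀ M N v i → ((M · N) *ᵥ v) i ≡ (M *ᵥ (N *ᵥ v)) i
  ·-*ᵥ M N v i = assoc (M i zero) (M i (suc zero)) (N zero zero) (N zero (suc zero))
                       (N (suc zero) zero) (N (suc zero) (suc zero)) (v zero) (v (suc zero))
    where
    assoc : ∀ a b p q r s x y →
            (a * p + b * r) * x + (a * q + b * s) * y ≡ a * (p * x + q * y) + b * (r * x + s * y)
    assoc = solve-∀

  -- Twice the matrix (M² − m·I)/2 + M of the paper.
  doubleHalvedQuotient : ℕ → Mat → Mat
  doubleHalvedQuotient m M i j = (M · M) i j - + m * δ i j + + 2 * M i j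

  doubleHalvedQuotient-*ᵥ : ∀ m M v i →
    (doubleHalvedQuotient m M *ᵥ v) i ≡ (M *ᵥ (M *ᵥ v)) i - + m * v i + + 2 * (M *ᵥ v) i
  doubleHalvedQuotient-*ᵥ m M v i =
    trans (expand ((M · M) i zero) ((M · M) i (suc zero)) (δ i zero) (δ i (suc zero))
                  (M i zero) (M i (suc zero)) (+ m) (v zero) (v (suc zero)))
          (cong₂ (λ s t → s - + m * t + + 2 * (M *ᵥ v) i) (·-*ᵥ M M v i) (δ-*ᵥ v i))
    where
    expand : ∀ p q d₀ d₁ a b k x y →
             (p - k * d₀ + + 2 * a) * x + (q - k * d₁ + + 2 * b) * y
               ≡ (p * x + q * y) - k * (d₀ * x + d₁ * y) + + 2 * (a * x + b * y)
    expand = solve-∀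

  doubleHalvedQuotient-eigen : ∀ m M v μ → (∀ i → (M *ᵥ v) i ≡ μ * v i) →
    ∀ i → (doubleHalvedQuotient m M *ᵥ v) i ≡ (μ * μ - + m + + 2 * μ) * v i
  doubleHalvedQuotient-eigen m M v μ Mv≡μv i = begin
      (doubleHalvedQuotient m M *ᵥ v) i
    ≡⟨ doubleHalvedQuotient-*ᵥ m M v i ⟩
      (M *ᵥ (M *ᵥ v)) i - + m * v i + + 2 * (M *ᵥ v) i
    ≡⟨ cong₂ (λ s t → s - + m * v i + + 2 * t) M²v≡μ²v (Mv≡μv i) ⟩
      μ * (μ * v i) - + m * v i + + 2 * (μ * v i)
    ≡⟨ collect μ (+ m) (v i) ⟩
      (μ * μ - + m + + 2 * μ) * v i ∎
    where
    open ≡-Reasoning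
    pull : ∀ a b μ x y → a * (μ * x) + b * (μ * y) ≡ μ * (a * x + b * y)
    pull = solve-∀
    collect : ∀ μ k x → μ * (μ * x) - k * x + + 2 * (μ * x) ≡ (μ * μ - k + + 2 * μ) * x
    collect = solve-∀
    M²v≡μ²v : (M *ᵥ (M *ᵥ v)) i ≡ μ * (μ * v i)
    M²v≡μ²v = trans (cong₂ (λ s t → M i zero * s + M i (suc zero) * t) (Mv≡μv zero) (Mv≡μv (suc zero)))
                (trans (pull (M i zero) (M i (suc zero)) μ (v zero) (v (suc zero))) (cong (μ *_) (Mv≡μv i)))

  S′-eigenvector : ℕ → ℤ → Fin 2 → ℤ
  S′-eigenvector n c zero       = + n - c
  S′-eigenvector n c (suc zero) = - c

  S′-eigen : ∀ n c i → (S′ n c *ᵥ S′-eigenvector n c) i ≡ - S′-eigenvector n c i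
  S′-eigen n c zero       = row₀ (+ n) c
    where
    row₀ : ∀ k c → (c - 1ℤ) * (k - c) + (k - c) * (- c) ≡ - (k - c)
    row₀ = solve-∀
  S′-eigen n c (suc zero) = row₁ (+ n) c
    where
    row₁ : ∀ k c → c * (k - c) + (k - c - 1ℤ) * (- c) ≡ - (- c)
    row₁ = solve-∀

  S′-eigenvector≢0 : ∀ m c → ¬ (∀ i → S′-eigenvector (suc m) c i ≡ 0ℤ)
  S′-eigenvector≢0 m c v≡0 with trans (sym (ℤ.neg-involutive c)) (cong -_ (v≡0 (suc zero)))
  ... | refl with v≡0 zero
  ... | ()

  S′-shape : ∀ m (M : Mat) → (∀ i → M i zero + M i (suc zero) ≡ + m) →
             M zero zero ≡ M (suc zero) zero - 1ℤ → ∀ i j → M i j ≡ S′ (suc m) (M (suc zero) zero) i j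
  S′-shape m M rows M₀₀≡ zero       zero       = M₀₀≡
  S′-shape m M rows M₀₀≡ zero       (suc zero) = begin
      M zero (suc zero)
    ≡⟨ complement (M zero zero) (M zero (suc zero)) ⟩
      (M zero zero + M zero (suc zero)) - M zero zero
    ≡⟨ cong₂ _-_ (rows zero) M₀₀≡ ⟩
      + m - (M (suc zero) zero - 1ℤ)
    ≡⟨ shift (+ m) (M (suc zero) zero) ⟩
      + suc m - M (suc zero) zero ∎
    where
    open ≡-Reasoning
    complement : ∀ a b → b ≡ (a + b) - a
    complement = solve-∀
    shift : ∀ k c → k - (c - 1ℤ) ≡ (1ℤ + k) - c
    shift = solve-∀
  S′-shape m M rows M₀₀≡ (suc zero) zero       = refl
  S′-shape m M rows M₀₀≡ (suc zero) (suc zero) =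
    trans (complement (M (suc zero) zero) (M (suc zero) (suc zero)))
          (cong (λ t → (1ℤ + t) - M (suc zero) zero - 1ℤ) (rows (suc zero)))
    where
    complement : ∀ c b → b ≡ (1ℤ + (c + b)) - c - 1ℤ
    complement = solve-∀

  module Partition {m : ℕ} (Q : Word m → Fin 2) where

    χ : Fin 2 → Word m → ℤ
    χ j z = 𝟙 ⌊ Q z ≟ j ⌋

    Quotient : ((Word m → ℤ) → Word m → ℤ) → Mat → Set
    Quotient L M = ∀ y j → L (χ j) y ≡ M (Q y) j

    χ≡δ : ∀ y j → χ j y ≡ δ (Q y) j
    χ≡δ y j with ⌊ Q y ≟ j ⌋
    ... | true  = refl
    ... | false = refl

    lift-decompose : ∀ (v : Fin 2 → ℤ) z → v (Q z) ≡ v zero * χ zero z + v (suc zero) * χ (suc zero) z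
    lift-decompose v z with Q z
    ... | zero     = first (v zero) (v (suc zero))
      where
      first : ∀ a b → a ≡ a * 1ℤ + b * 0ℤ
      first = solve-∀
    ... | suc zero = second (v zero) (v (suc zero))
      where
      second : ∀ a b → b ≡ a * 0ℤ + b * 1ℤ
      second = solve-∀

    A-lift : ∀ d (v : Fin 2 → ℤ) y →
             A m d (λ z → v (Q z)) y ≡ v zero * A m d (χ zero) y + v (suc zero) * A m d (χ (suc zero)) y
    A-lift d v y =
      trans (A-cong m d (lift-decompose v) y)
            (trans (A-+ m d (λ z → v zero * χ zero z) (λ z → v (suc zero) * χ (suc zero) z) y)
                   (cong₂ _+_ (A-*ˡ m d (v zero) (χ zero) y) (A-*ˡ m d (v (suc zero)) (χ (suc zero)) y)))

    A-χ-sum : ∀ y → A m 1 (χ zero) y + A m 1 (χ (suc zero)) y ≡ + m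
    A-χ-sum y =
      trans (sym (A-+ m 1 (χ zero) (χ (suc zero)) y)) (trans (A-cong m 1 χ-sum y) (A-const m y))
      where
      χ-sum : ∀ z → χ zero z + χ (suc zero) z ≡ 1ℤ
      χ-sum z with Q z
      ... | zero     = refl
      ... | suc zero = refl

    A½-lift : ∀ {M} → Quotient (A½ m) M → ∀ v y → A½ m (λ z → v (Q z)) y ≡ (M *ᵥ v) (Q y)
    A½-lift {M} quotient v y = begin
        A m 1 (λ z → v (Q z)) y + A m 2 (λ z → v (Q z)) y
      ≡⟨ cong₂ _+_ (A-lift 1 v y) (A-lift 2 v y) ⟩
        (v zero * A m 1 (χ zero) y + v (suc zero) * A m 1 (χ (suc zero)) y)
          + (v zero * A m 2 (χ zero) y + v (suc zero) * A m 2 (χ (suc zero)) y)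
      ≡⟨ regroup (v zero) (v (suc zero)) _ _ _ _ ⟩
        A½ m (χ zero) y * v zero + A½ m (χ (suc zero)) y * v (suc zero)
      ≡⟨ cong₂ (λ s t → s * v zero + t * v (suc zero)) (quotient y zero) (quotient y (suc zero)) ⟩
        (M *ᵥ v) (Q y) ∎
      where
      open ≡-Reasoning
      regroup : ∀ v₀ v₁ a b c d → (v₀ * a + v₁ * b) + (v₀ * c + v₁ * d) ≡ (a + c) * v₀ + (b + d) * v₁
      regroup = solve-∀

    A²-quotient : ∀ {M} → Quotient (A m 1) M → ∀ y j → A m 1 (A m 1 (χ j)) y ≡ (M · M) (Q y) j
    A²-quotient {M} quotient y j = begin
        A m 1 (A m 1 (χ j)) y
      ≡⟨ A-cong m 1 (λ z → quotient z j) y ⟩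
        A m 1 (λ z → M (Q z) j) y
      ≡⟨ A-lift 1 (λ i → M i j) y ⟩
        M zero j * A m 1 (χ zero) y + M (suc zero) j * A m 1 (χ (suc zero)) y
      ≡⟨ cong₂ (λ s t → M zero j * s + M (suc zero) j * t) (quotient y zero) (quotient y (suc zero)) ⟩
        M zero j * M (Q y) zero + M (suc zero) j * M (Q y) (suc zero)
      ≡⟨ cong₂ _+_ (ℤ.*-comm (M zero j) _) (ℤ.*-comm (M (suc zero) j) _) ⟩
        (M · M) (Q y) j ∎
      where open ≡-Reasoning

    -- A½ = A + (A² − m·I)/2, read off on the cells.
    A½-quotient : ∀ {M} → Quotient (A m 1) M →
                  ∀ y j → + 2 * A½ m (χ j) y ≡ doubleHalvedQuotient m M (Q y) j
    A½-quotient {M} quotient y j = begin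
        + 2 * (A m 1 (χ j) y + A m 2 (χ j) y)
      ≡⟨ complete (A m 1 (χ j) y) (A m 2 (χ j) y) (+ m) (χ j y) ⟩
        (+ m * χ j y + + 2 * A m 2 (χ j) y) - + m * χ j y + + 2 * A m 1 (χ j) y
      ≡⟨ cong₂ (λ s t → s - + m * χ j y + + 2 * t) (sym (A-square m (χ j) y)) (quotient y j) ⟩
        A m 1 (A m 1 (χ j)) y - + m * χ j y + + 2 * M (Q y) j
      ≡⟨ cong₂ (λ s t → s - + m * t + + 2 * M (Q y) j) (A²-quotient {M} quotient y j) (χ≡δ y j) ⟩
        doubleHalvedQuotient m M (Q y) j ∎
      where
      open ≡-Reasoning
      complete : ∀ a a₂ k x → + 2 * (a + a₂) ≡ (k * x + + 2 * a₂) - k * x + + 2 * a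
      complete = solve-∀

    cubeCounts⇒quotient : ∀ {T} →
      (∀ y → y ∈ words m → ∀ j →
         countB (λ w → adj (H m) y w ∧ ⌊ Q w ≟ j ⌋) (words m) ≡ T (Q y) j) →
                          Quotient (A m 1) (toℤM T)
    cubeCounts⇒quotient counts y j = trans (sym (cube-neighbours m _ y)) (cong +_ (counts y (∈-words y) j))

    quotient⇒cubeCounts : ∀ {T} → Quotient (A m 1) (toℤM T) →
      ∀ y → y ∈ words m → ∀ j →
        countB (λ w → adj (H m) y w ∧ ⌊ Q w ≟ j ⌋) (words m) ≡ T (Q y) j
    quotient⇒cubeCounts quotient y _ j = ℤ.+-injective (trans (cube-neighbours m _ y) (quotient y j))

    -- If v ∘ Q is an eigenfunction of A for -1 and v₀ ≠ v₁, the number of neighbours in the cell C₀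
    -- is an affine function of v (Q y) (cellCount), hence constant on each cell.
    module Eigenvector (v : Fin 2 → ℤ) (v≢0 : ¬ (∀ i → v i ≡ 0ℤ))
                       (A-eigen : ∀ y → A m 1 (λ z → v (Q z)) y ≡ - v (Q y)) where

      private
        v₀ v₁ : ℤ
        v₀ = v zero
        v₁ = v (suc zero)

      cellCount : ∀ y → (v₀ - v₁) * A m 1 (χ zero) y ≡ - v (Q y) - v₁ * + m
      cellCount y = begin
          (v₀ - v₁) * A m 1 (χ zero) y
        ≡⟨ rearrange v₀ v₁ (A m 1 (χ zero) y) (A m 1 (χ (suc zero)) y) ⟩
          (v₀ * A m 1 (χ zero) y + v₁ * A m 1 (χ (suc zero)) y)
            - v₁ * (A m 1 (χ zero) y + A m 1 (χ (suc zero)) y)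
        ≡⟨ cong₂ (λ s t → s - v₁ * t) (trans (sym (A-lift 1 v y)) (A-eigen y)) (A-χ-sum y) ⟩
          - v (Q y) - v₁ * + m ∎
        where
        open ≡-Reasoning
        rearrange : ∀ v₀ v₁ a b → (v₀ - v₁) * a ≡ (v₀ * a + v₁ * b) - v₁ * (a + b)
        rearrange = solve-∀

      v₀-v₁≢0 : v₀ - v₁ ≢ 0ℤ
      v₀-v₁≢0 v₀-v₁≡0 = v≢0 (λ i → trans (v≡v₁ i) v₁≡0)
        where
        v≡v₁ : ∀ i → v i ≡ v₁
        v≡v₁ zero       = ℤ.i-j≡0⇒i≡j v₀ v₁ v₀-v₁≡0
        v≡v₁ (suc zero) = refl
        y₀ : Word m
        y₀ = replicate m false
        0≡-v₁-v₁m : 0ℤ ≡ - v₁ - v₁ * + m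
        0≡-v₁-v₁m = trans (sym (trans (cong (_* A m 1 (χ zero) y₀) v₀-v₁≡0)
                                      (ℤ.*-zeroˡ (A m 1 (χ zero) y₀))))
                          (trans (cellCount y₀) (cong (λ t → - t - v₁ * + m) (v≡v₁ (Q y₀))))
        negate : ∀ a k → a * (1ℤ + k) ≡ - (- a - a * k)
        negate = solve-∀
        v₁[1+m]≡0 : v₁ * (1ℤ + + m) ≡ 0ℤ
        v₁[1+m]≡0 = trans (negate v₁ (+ m)) (cong -_ (sym 0≡-v₁-v₁m))
        v₁≡0 : v₁ ≡ 0ℤ
        v₁≡0 with ℤ.i*j≡0⇒i≡0∨j≡0 v₁ v₁[1+m]≡0
        ... | inj₁ v₁≡0 = v₁≡0
        ... | inj₂ ()

      cancel : ∀ {a b} → (v₀ - v₁) * a ≡ (v₀ - v₁) * b → a ≡ b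
      cancel {a} {b} = ℤ.*-cancelˡ-≡ (v₀ - v₁) a b {{≢-nonZero v₀-v₁≢0}}

      A-χ-cellwise : ∀ j {y z} → Q y ≡ Q z → A m 1 (χ j) y ≡ A m 1 (χ j) z
      A-χ-cellwise zero {y} {z} Qy≡Qz =
        cancel (trans (cellCount y) (trans (cong (λ i → - v i - v₁ * + m) Qy≡Qz) (sym (cellCount z))))
      A-χ-cellwise (suc zero) {y} {z} Qy≡Qz =
        trans (complement y) (trans (cong (λ t → + m - t) (A-χ-cellwise zero Qy≡Qz)) (sym (complement z)))
        where
        complement : ∀ y → A m 1 (χ (suc zero)) y ≡ + m - A m 1 (χ zero) y
        complement y = trans (subtract (A m 1 (χ zero) y) _) (cong (_- A m 1 (χ zero) y) (A-χ-sum y))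
          where
          subtract : ∀ a b → b ≡ (a + b) - a
          subtract = solve-∀

      A-χ₀-step : ∀ {y z} → Q y ≡ zero → Q z ≡ suc zero → A m 1 (χ zero) y ≡ A m 1 (χ zero) z - 1ℤ
      A-χ₀-step {y} {z} Qy≡0 Qz≡1 = cancel (begin
          (v₀ - v₁) * A m 1 (χ zero) y
        ≡⟨ trans (cellCount y) (cong (λ i → - v i - v₁ * + m) Qy≡0) ⟩
          - v₀ - v₁ * + m
        ≡⟨ shift v₀ v₁ (+ m) ⟩
          (- v₁ - v₁ * + m) - (v₀ - v₁)
        ≡⟨ cong (_- (v₀ - v₁)) (sym (trans (cellCount z) (cong (λ i → - v i - v₁ * + m) Qz≡1))) ⟩
          (v₀ - v₁) * A m 1 (χ zero) z - (v₀ - v₁)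
        ≡⟨ factor (v₀ - v₁) (A m 1 (χ zero) z) ⟩
          (v₀ - v₁) * (A m 1 (χ zero) z - 1ℤ) ∎)
        where
        open ≡-Reasoning
        shift : ∀ v₀ v₁ k → - v₀ - v₁ * k ≡ (- v₁ - v₁ * k) - (v₀ - v₁)
        shift = solve-∀
        factor : ∀ d a → d * a - d ≡ d * (a - 1ℤ)
        factor = solve-∀

  halvedCounts⇒quotient : ∀ m (P : Word (suc m) → Fin 2) {S} →
    (∀ x → x ∈ vertices (halfH (suc m)) → ∀ j →
       countB (λ w → adj (halfH (suc m)) x w ∧ ⌊ P w ≟ j ⌋) (vertices (halfH (suc m))) ≡ S (P x) j) →
    Partition.Quotient (λ y → P (extendEven y)) (A½ m) (toℤM S)
  halvedCounts⇒quotient m P counts y j =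
    trans (sym (halvedCube-neighbours m _ y)) (cong +_ (counts (extendEven y) (extendEven-∈ m y) j))

  quotient⇒halvedCounts : ∀ m (P : Word (suc m) → Fin 2) {S} →
    Partition.Quotient (λ y → P (extendEven y)) (A½ m) (toℤM S) →
    ∀ x → x ∈ vertices (halfH (suc m)) → ∀ j →
      countB (λ w → adj (halfH (suc m)) x w ∧ ⌊ P w ≟ j ⌋) (vertices (halfH (suc m))) ≡ S (P x) j
  quotient⇒halvedCounts m P {S} quotient x x∈ j =
    subst (λ x → countB (λ w → adj (halfH (suc m)) x w ∧ ⌊ P w ≟ j ⌋) (vertices (halfH (suc m)))
                   ≡ S (P x) j)
          (∈⇒extendEven-deleteLast m x∈)
          (ℤ.+-injective (trans (halvedCube-neighbours m _ (deleteLast x)) (quotient (deleteLast x) j)))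

  halvedQuotient-eigen : ∀ m θ → + 2 * θ ≡ - + suc m → ∀ (S T : Mat) c →
    (∀ i j → T i j ≡ S′ (suc m) c i j) → (∀ i j → + 2 * S i j ≡ doubleHalvedQuotient m T i j) →
    ∀ i → (S *ᵥ S′-eigenvector (suc m) c) i ≡ θ * S′-eigenvector (suc m) c i
  halvedQuotient-eigen m θ 2θ≡-n S T c T≡S′ 2S≡ i = ℤ.*-cancelˡ-≡ (+ 2) _ _ (begin
      + 2 * (S *ᵥ v) i
    ≡⟨ double (S i zero) (S i (suc zero)) (v zero) (v (suc zero)) ⟩
      ((λ i j → + 2 * S i j) *ᵥ v) i
    ≡⟨ *ᵥ-cong 2S≡ v i ⟩
      (doubleHalvedQuotient m T *ᵥ v) i
    ≡⟨ doubleHalvedQuotient-eigen m T v -1ℤ Tv≡-v i ⟩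
      (-1ℤ * -1ℤ - + m + + 2 * -1ℤ) * v i
    ≡⟨ cong (_* v i) (trans (evaluate (+ m)) (sym 2θ≡-n)) ⟩
      (+ 2 * θ) * v i
    ≡⟨ ℤ.*-assoc (+ 2) θ (v i) ⟩
      + 2 * (θ * v i) ∎)
    where
    open ≡-Reasoning
    v : Fin 2 → ℤ
    v = S′-eigenvector (suc m) c
    Tv≡-v : ∀ i → (T *ᵥ v) i ≡ -1ℤ * v i
    Tv≡-v i = trans (*ᵥ-cong T≡S′ v i) (trans (S′-eigen (suc m) c i) (sym (ℤ.-1*i≡-i (v i))))
    double : ∀ a b x y → + 2 * (a * x + b * y) ≡ (+ 2 * a) * x + (+ 2 * b) * y
    double = solve-∀
    evaluate : ∀ k → -1ℤ * -1ℤ - k + + 2 * -1ℤ ≡ - (1ℤ + k)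
    evaluate = solve-∀

  EquitableOnCube : ∀ m → (Word (suc m) → Fin 2) → (Fin 2 → Fin 2 → ℕ) → Set
  EquitableOnCube m P S = Σ ℤ λ c → Σ (Fin 2 → Fin 2 → ℕ) λ T →
      ((i j : Fin 2) → toℤM T i j ≡ S′ (suc m) c i j)
    × IsEquitable (H m) (λ y → P (extendEven y)) T
    × ((i j : Fin 2) → + 2 * toℤM S i j ≡ doubleHalvedQuotient m (toℤM T) i j)

  halvedEquitable⇒cubeEquitable : ∀ m θ → + 2 * θ ≡ - + suc m → ∀ P S →
    IsEquitable (halfH (suc m)) P S × HasEigenvalue (toℤM S) θ → EquitableOnCube m P S
  halvedEquitable⇒cubeEquitable m θ 2θ≡-n P S ((nonempty , counts) , (v , v≢0 , Sv≡θv)) =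
    + T (suc zero) zero , T , T≡S′ ,
    ((λ i → rep i , ∈-words (rep i) , Q-rep i) , quotient⇒cubeCounts {T} cubeQuotient) , 2S≡
    where
    Q : Word m → Fin 2
    Q y = P (extendEven y)
    open Partition Q
    rep : Fin 2 → Word m
    rep i = deleteLast (proj₁ (nonempty i))
    Q-rep : ∀ i → Q (rep i) ≡ i
    Q-rep i = trans (cong P (∈⇒extendEven-deleteLast m (proj₁ (proj₂ (nonempty i)))))
                    (proj₂ (proj₂ (nonempty i)))
    halvedQuotient : Quotient (A½ m) (toℤM S)
    halvedQuotient = halvedCounts⇒quotient m P {S} counts
    A-eigen : ∀ y → A m 1 (λ z → v (Q z)) y ≡ - v (Q y)
    A-eigen = A½-eigen⇒A-eigen m θ 2θ≡-n (λ z → v (Q z))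
                (λ y → trans (A½-lift {toℤM S} halvedQuotient v y) (Sv≡θv (Q y)))
    open Eigenvector v v≢0 A-eigen
    T : Fin 2 → Fin 2 → ℕ
    T i j = countB (λ w → adj (H m) (rep i) w ∧ ⌊ Q w ≟ j ⌋) (words m)
    T≡A : ∀ i j → toℤM T i j ≡ A m 1 (χ j) (rep i)
    T≡A i j = cube-neighbours m _ (rep i)
    cubeQuotient : Quotient (A m 1) (toℤM T)
    cubeQuotient y j = trans (A-χ-cellwise j (sym (Q-rep (Q y)))) (sym (T≡A (Q y) j))
    T≡S′ : ∀ i j → toℤM T i j ≡ S′ (suc m) (+ T (suc zero) zero) i j
    T≡S′ = S′-shape m (toℤM T)
      (λ i → trans (cong₂ _+_ (T≡A i zero) (T≡A i (suc zero))) (A-χ-sum (rep i)))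
      (trans (T≡A zero zero) (trans (A-χ₀-step (Q-rep zero) (Q-rep (suc zero)))
                                    (cong (_- 1ℤ) (sym (T≡A (suc zero) zero)))))
    2S≡ : ∀ i j → + 2 * toℤM S i j ≡ doubleHalvedQuotient m (toℤM T) i j
    2S≡ i j = subst (λ k → + 2 * toℤM S k j ≡ doubleHalvedQuotient m (toℤM T) k j) (Q-rep i)
                (trans (cong (+ 2 *_) (sym (halvedQuotient (rep i) j)))
                       (A½-quotient {toℤM T} cubeQuotient (rep i) j))

  cubeEquitable⇒halvedEquitable : ∀ m θ → + 2 * θ ≡ - + suc m → ∀ P S →
    EquitableOnCube m P S → IsEquitable (halfH (suc m)) P S × HasEigenvalue (toℤM S) θ
  cubeEquitable⇒halvedEquitable m θ 2θ≡-n P S (c , T , T≡S′ , (nonempty , counts) , 2S≡) =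
    ((λ i → extendEven (proj₁ (nonempty i)) , extendEven-∈ m _ , proj₂ (proj₂ (nonempty i))) ,
     quotient⇒halvedCounts m P {S} halvedQuotient) ,
    (S′-eigenvector (suc m) c , S′-eigenvector≢0 m c ,
     halvedQuotient-eigen m θ 2θ≡-n (toℤM S) (toℤM T) c T≡S′ 2S≡)
    where
    open Partition (λ y → P (extendEven y))
    halvedQuotient : Quotient (A½ m) (toℤM S)
    halvedQuotient y j = ℤ.*-cancelˡ-≡ (+ 2) _ _
      (trans (A½-quotient {toℤM T} (cubeCounts⇒quotient {T} counts) y j) (sym (2S≡ _ j)))

open import Defs
open import Data.Nat using (ℕ; suc; _*_; _∸_)
open import Data.Integer using (ℤ; +_; -_; _-_; _+_) renaming (_*_ to _*ℤ_)
open import Data.Integer.Properties using (neg-distribʳ-*)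
open import Data.Fin using (Fin)
open import Data.Vec using (Vec)
open import Data.Bool using (Bool)
open import Data.Product using (Σ; _×_)
open import Function.Bundles using (_⇔_; mk⇔)
open import Relation.Binary.PropositionalEquality using (_≡_; sym)
open HalvedCube using (halvedEquitable⇒cubeEquitable; cubeEquitable⇒halvedEquitable)

theorem2 : (h : ℕ) → (P : Vec Bool (2 * suc h) → Fin 2) → (S : Fin 2 → Fin 2 → ℕ) →
    (IsEquitable (halfH (2 * suc h)) P S × HasEigenvalue (toℤM S) (- (+ suc h)))
    ⇔ (Σ ℤ λ c → Σ (Fin 2 → Fin 2 → ℕ) λ T →
         ((i j : Fin 2) → toℤM T i j ≡ S′ (2 * suc h) c i j)
         × IsEquitable (H (2 * suc h ∸ 1)) (λ y → P (extendEven y)) T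
         × ((i j : Fin 2) → + 2 *ℤ toℤM S i j
              ≡ (toℤM T · toℤM T) i j - + (2 * suc h ∸ 1) *ℤ δ i j + + 2 *ℤ toℤM T i j))
theorem2 h P S =
  mk⇔ (halvedEquitable⇒cubeEquitable m θ 2θ≡-n P S) (cubeEquitable⇒halvedEquitable m θ 2θ≡-n P S)
  where
  -- suc m reduces to 2 * suc h, so the general lemmas apply verbatim.
  m : ℕ
  m = 2 * suc h ∸ 1
  θ : ℤ
  θ = - (+ suc h)
  2θ≡-n : + 2 *ℤ θ ≡ - (+ suc m)
  2θ≡-n = sym (neg-distribʳ-* (+ 2) (+ suc h))
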